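{- For every integer $n\ge 6$, the path $\mathcal{P}_n$ on $n$ vertices has at least $(\lceil\sqrt{n-1}\,\rceil-1)!$ pairwise nonequivalent optimal cointersection representations.
   Context: Graphs are finite, simple and undirected. For a graph $\mathcal{G}=(\mathcal{V},\mathcal{E})$ and positive integers $\alpha,\beta$, an $(\alpha\mid\beta)$-cointersection representation (CIR) of $\mathcal{G}$ consists of two disjoint finite sets of features $\mathcal{A},\mathcal{B}$ with $|\mathcal{A}|=\alpha$, $|\mathcal{B}|=\beta$, together with an assignment to each vertex $v$ of subsets $A_v\subseteq\mathcal{A}$, $B_v\subseteq\mathcal{B}$ (possibly empty), such that for all distinct $u,v\in\mathcal{V}$: $(u,v)\in\mathcal{E}$ if and only if $A_u\cap A_v\neq\varnothing$ and $B_u\cap B_v\neq\varnothing$. The cointersection number $\theta^{c}(\mathcal{G})$ is the minimum of $\alpha+\beta$ over all CIRs of $\mathcal{G}$; a CIR is optimal if $\alpha+\beta=\theta^{c}(\mathcal{G})$. Two CIRs $(\mathcal{A},\mathcal{B},(A_v,B_v)_v)$ and $(\mathcal{A}',\mathcal{B}',(A'_v,B'_v)_v)$ of the same graph are equivalent if either there are bijections $\varphi:\mathcal{A}\to\mathcal{A}'$, $\psi:\mathcal{B}\to\mathcal{B}'$ with $A'_v=\varphi(A_v)$ and $B'_v=\psi(B_v)$ for all $v$, or there are bijections $\varphi:\mathcal{A}\to\mathcal{B}'$, $\psi:\mathcal{B}\to\mathcal{A}'$ with $B'_v=\varphi(A_v)$ and $A'_v=\psi(B_v)$ for all $v$ (i.e.,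 one is obtained from the other by permuting features within each set and possibly swapping the roles of the two feature sets). -}

module Defs where

open import Data.Nat using (ℕ; suc; _≤_; _<_; _+_; _*_; _∸_)
open import Data.Fin using (Fin; toℕ)
open import Data.Fin.Subset using (Subset; _∈_; _∩_; Nonempty)
open import Data.Product using (Σ; _×_; ∃)
open import Data.Sum using (_⊎_)
open import Function.Bundles using (_⇔_; _⤖_; Bijection)
open import Relation.Binary.PropositionalEquality using (_≡_; _≢_)

PathAdj : (n : ℕ) → Fin n → Fin n → Set
PathAdj n u v = (suc (toℕ u) ≡ toℕ v) ⊎ (suc (toℕ v) ≡ toℕ u)

record CIR (n : ℕ) : Set where
  field
    α : ℕ
    β : ℕ
    A : Fin n → Subset α
    B : Fin n → Subset β

open CIR public

size : ∀ {n} → CIR n → ℕ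
size R = α R + β R

IsCIR : ∀ {n} → (Fin n → Fin n → Set) → CIR n → Set
IsCIR {n} E R =
  (1 ≤ α R) × (1 ≤ β R) ×
  (∀ (u v : Fin n) → u ≢ v →
     (E u v ⇔ (Nonempty (A R u ∩ A R v) × Nonempty (B R u ∩ B R v))))

IsOptimalCIR : ∀ {n} → (Fin n → Fin n → Set) → CIR n → Set
IsOptimalCIR E R = IsCIR E R × (∀ (R' : CIR _) → IsCIR E R' → size R ≤ size R')

IsImage : ∀ {a b} → (Fin a → Fin b) → Subset a → Subset b → Set
IsImage {a} {b} f X Y = ∀ (y : Fin b) → (y ∈ Y ⇔ ∃ λ (x : Fin a) → (x ∈ X) × (f x ≡ y))

Equivalent : ∀ {n} → CIR n → CIR n → Set
Equivalent {n} R R' =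
  (Σ (Fin (α R) ⤖ Fin (α R')) λ φ → Σ (Fin (β R) ⤖ Fin (β R')) λ ψ →
     ∀ (v : Fin n) → IsImage (Bijection.to φ) (A R v) (A R' v)
                   × IsImage (Bijection.to ψ) (B R v) (B R' v))
  ⊎
  (Σ (Fin (α R) ⤖ Fin (β R')) λ φ → Σ (Fin (β R) ⤖ Fin (α R')) λ ψ →
     ∀ (v : Fin n) → IsImage (Bijection.to φ) (A R v) (B R' v)
                   × IsImage (Bijection.to ψ) (B R v) (A R' v))

-- s = ⌈√m⌉ (for m ≥ 1): (s-1)² < m ≤ s².
IsCeilSqrt : ℕ → ℕ → Set
IsCeilSqrt m s = ((s ∸ 1) * (s ∸ 1) < m) × (m ≤ s * s)

-- Write n = N + 1, so P_n has the N edges m = {m, m+1}, and s = s′ + 1 = ⌈√N⌉.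
-- Lower bound: in any CIR the pairs (common A-feature, common B-feature) of
-- the N edges are pairwise distinct, so N ≤ α·β, and AM–GM turns N > s′·s′
-- (resp. N > s′·s) into α + β ≥ 2s′ + 1 (resp. 2s′ + 2).
-- Upper bound: place the edges injectively in the cells of an α × s grid so
-- that consecutive edges share a row or a column (a rook walk); the rows and
-- the columns of the edges at a vertex are then its A- and B-features, which
-- gives a CIR of size α + s.  We walk the grid row by row, reading row 0 left
-- to right and the later rows alternately in an order ρ and in ρ reversed;
-- ρ starts in the last column and continues with an arbitrary ordering of the
-- other s′ columns, encoded by a Lehmer code in Fin (s′ !).
-- Distinct codes give non-equivalent CIRs: swapping the roles of A and B
-- fails at vertex 1, and a column bijection preserving all B-sets is forced,
-- edge by edge, to be the identity, so the second rows and hence the codes agree.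

module Submission where

open import Defs
open import Data.Nat using (ℕ; _≤_; _∸_; _!)
open import Data.Fin using (Fin)
open import Data.Product using (Σ; _×_)
open import Relation.Binary.PropositionalEquality using (_≢_)
open import Relation.Nullary using (¬_)

open import Data.Nat using (zero; suc; _+_; _*_; _<_; _≤?_; _<?_; _≟_; z≤n; s≤s; s≤s⁻¹; NonZero)
open import Data.Nat.Properties
open import Data.Nat.DivMod using (_/_; _%_; m≡m%n+[m/n]*n; m%n<n; m<n⇒m%n≡m; m<n⇒m/n≡0; [m+kn]%n≡m%n; +-distrib-/-∣ʳ; m*n/n≡m; m<n*o⇒m/o<n)
open import Data.Nat.Divisibility using (divides-refl)
open import Data.Fin using (toℕ; fromℕ<; inject₁; punchIn; remQuot; combine) renaming (zero to fzero; suc to fsuc)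
open import Data.Fin.Properties using (toℕ<n; toℕ-injective; toℕ-fromℕ<; fromℕ<-toℕ; fromℕ<-injective; toℕ-inject₁; pigeonhole; combine-injective; combine-remQuot; punchIn-injective; punchInᵢ≢i)
open import Data.Fin.Subset using (Subset; _∈_; _∩_; Nonempty)
open import Data.Fin.Subset.Properties using (x∈p∩q⁺; x∈p∩q⁻)
open import Data.Vec using (tabulate)
open import Data.Vec.Properties using (lookup∘tabulate; []=⇒lookup; lookup⇒[]=)
open import Data.Bool using (true)
open import Data.Product using (_,_; proj₁; proj₂; ∃)
open import Data.Sum using (_⊎_; inj₁; inj₂)
open import Data.Empty using (⊥-elim)
open import Function using (_∘_)
open import Function.Bundles using (_⇔_; Equivalence; mk⇔; _⤖_; Bijection)
open import Relation.Binary.PropositionalEquality using (_≡_; refl; sym; trans; cong; cong₂; subst; module ≡-Reasoning)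
open import Relation.Nullary using (yes; no; does; contradiction)
open import Relation.Nullary.Decidable using (Dec; dec-true; _×-dec_; _⊎-dec_)
open import Relation.Unary using (Decidable)

-- AM–GM, balanced core: if a ≤ k ≤ l then a + b ≤ k + l forces a·b ≤ k·l.
-- Writing k = a + d gives b ≤ d + l, and a·d ≤ l·d absorbs the excess.
*-≤-balanced : ∀ {a b k l} → a ≤ k → k ≤ l → a + b ≤ k + l → a * b ≤ k * l
*-≤-balanced {a} {b} {k} {l} a≤k k≤l a+b≤k+l with m≤n⇒∃[o]m+o≡n a≤k
... | d , refl = begin
  a * b          ≤⟨ *-monoʳ-≤ a b≤d+l ⟩
  a * (d + l)    ≡⟨ *-distribˡ-+ a d l ⟩
  a * d + a * l  ≤⟨ +-monoˡ-≤ (a * l) (*-monoˡ-≤ d (≤-trans a≤k k≤l)) ⟩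
  l * d + a * l  ≡⟨ trans (+-comm (l * d) (a * l)) (cong (a * l +_) (*-comm l d)) ⟩
  a * l + d * l  ≡⟨ *-distribʳ-+ l a d ⟨
  (a + d) * l    ∎
  where
  open ≤-Reasoning
  b≤d+l : b ≤ d + l
  b≤d+l = +-cancelˡ-≤ a b (d + l) (≤-trans a+b≤k+l (≤-reflexive (+-assoc a d l)))

-- AM–GM over ℕ for nearly balanced bounds: if l ∈ {k, k+1} and a + b ≤ k + l
-- then a·b ≤ k·l.  If a exceeds k then b ≤ k, and the roles of a, b swap.
*-≤-near-square : ∀ {a b k l} → k ≤ l → l ≤ suc k → a + b ≤ k + l → a * b ≤ k * l
*-≤-near-square {a} {b} {k} {l} k≤l l≤1+k a+b≤k+l with a ≤? k
... | yes a≤k = *-≤-balanced a≤k k≤l a+b≤k+l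
... | no a≰k  = subst (_≤ k * l) (*-comm b a) (*-≤-balanced b≤k k≤l b+a≤k+l)
  where
  b+a≤k+l : b + a ≤ k + l
  b+a≤k+l = subst (_≤ k + l) (+-comm a b) a+b≤k+l
  b≤k : b ≤ k
  b≤k = +-cancelʳ-≤ a b k (≤-trans b+a≤k+l (+-monoʳ-≤ k (≤-trans l≤1+k (≰⇒> a≰k))))

+-lower-bound : ∀ {a b k l} → k ≤ l → l ≤ suc k → k * l < a * b → k + l < a + b
+-lower-bound {a} {b} k≤l l≤1+k kl<ab =
  ≰⇒> (<⇒≱ kl<ab ∘ *-≤-near-square {a} {b} k≤l l≤1+k)

far-apart : ∀ {n} {u v : Fin n} → suc (toℕ u) < toℕ v → u ≢ v × ¬ PathAdj n u v
far-apart {u = u} {v} u+1<v = distinct , not-adjacent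
  where
  distinct : u ≢ v
  distinct refl = <-irrefl refl (<-trans (n<1+n (toℕ u)) u+1<v)
  not-adjacent : ¬ PathAdj _ u v
  not-adjacent (inj₁ u+1≡v) = <-irrefl u+1≡v u+1<v
  not-adjacent (inj₂ v+1≡u) = <-asym (<-trans (n<1+n (toℕ u)) u+1<v) (subst (toℕ v <_) v+1≡u (n<1+n (toℕ v)))

∩-bridge : ∀ {n} {p q r t : Subset n} {x} → x ∈ p ∩ q → x ∈ r ∩ t → x ∈ p ∩ t
∩-bridge {p = p} {q} {r} {t} x∈p∩q x∈r∩t =
  x∈p∩q⁺ (proj₁ (x∈p∩q⁻ p q x∈p∩q) , proj₂ (x∈p∩q⁻ r t x∈r∩t))

-- In a CIR of the path P_{N+1} every edge e = {e, e+1} has a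
-- common A-feature and a common B-feature.  The resulting pairs are distinct
-- for distinct edges: if edges i < j shared their pair, the vertices i and
-- j+1 would share an A- and a B-feature without being adjacent.
module _ {N : ℕ} (R : CIR (suc N)) (rep : IsCIR (PathAdj (suc N)) R) where
  private
    edge-features : (e : Fin N) →
      Nonempty (A R (inject₁ e) ∩ A R (fsuc e)) × Nonempty (B R (inject₁ e) ∩ B R (fsuc e))
    edge-features e = Equivalence.to (proj₂ (proj₂ rep) (inject₁ e) (fsuc e) distinct) adjacent
      where
      adjacent : PathAdj (suc N) (inject₁ e) (fsuc e)
      adjacent = inj₁ (cong suc (toℕ-inject₁ e))
      distinct : inject₁ e ≢ fsuc e
      distinct same = <-irrefl (trans (sym (toℕ-inject₁ e)) (cong toℕ same)) (n<1+n (toℕ e))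

    edge-label : Fin N → Fin (α R * β R)
    edge-label e = combine (proj₁ (proj₁ (edge-features e))) (proj₁ (proj₂ (edge-features e)))

    glue : ∀ {n} {p q r t : Subset n} ((x , _) : Nonempty (p ∩ q)) ((y , _) : Nonempty (r ∩ t)) →
           x ≡ y → Nonempty (p ∩ t)
    glue (x , x∈) (_ , y∈) refl = x , ∩-bridge x∈ y∈

    edge-labels-distinct : ∀ i j → toℕ i < toℕ j → edge-label i ≢ edge-label j
    edge-labels-distinct i j i<j same
      with combine-injective _ _ _ _ same | far-apart {u = inject₁ i} {fsuc j} (s≤s (subst (_< toℕ j) (sym (toℕ-inject₁ i)) i<j))
    ... | a≡ , b≡ | distinct , not-adjacent =
      not-adjacent (Equivalence.from (proj₂ (proj₂ rep) (inject₁ i) (fsuc j) distinct)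
        (glue (proj₁ (edge-features i)) (proj₁ (edge-features j)) a≡ ,
         glue (proj₂ (edge-features i)) (proj₂ (edge-features j)) b≡))

  path-edges≤αβ : N ≤ α R * β R
  path-edges≤αβ with N ≤? α R * β R
  ... | yes N≤αβ = N≤αβ
  ... | no N≰αβ with pigeonhole (≰⇒> N≰αβ) edge-label
  ...   | i , j , i<j , same = ⊥-elim (edge-labels-distinct i j i<j same)

size-lower-bound : ∀ {N k l} → k ≤ l → l ≤ suc k → k * l < N →
                   ∀ R → IsCIR (PathAdj (suc N)) R → k + l < size R
size-lower-bound k≤l l≤1+k kl<N R rep = +-lower-bound {α R} {β R} k≤l l≤1+k (<-≤-trans kl<N (path-edges≤αβ R rep))

∈-tabulate : ∀ {K} {P : Fin K → Set} (P? : Decidable P) {y : Fin K} →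
             y ∈ tabulate (does ∘ P?) ⇔ P y
∈-tabulate P? {y} = mk⇔
  (λ y∈ → witness (P? y) (trans (sym (lookup∘tabulate (does ∘ P?) y)) ([]=⇒lookup y∈)))
  (λ Py → lookup⇒[]= y _ (trans (lookup∘tabulate (does ∘ P?) y) (dec-true (P? y) Py)))
  where
  witness : ∀ {Q : Set} (Q? : Dec Q) → does Q? ≡ true → Q
  witness (yes q) _ = q

-- Edge m of the path joins the vertices m and m + 1; Ends v m says that v is one of them.
Ends : ℕ → ℕ → Set
Ends v m = m ≡ v ⊎ suc m ≡ v

HasLabel : (f : ℕ → ℕ) (N v y : ℕ) → Set
HasLabel f N v y = ∃ λ m → m < N × Ends v m × f m ≡ y

hasLabel? : ∀ f N v y → Dec (HasLabel f N v y)
hasLabel? f N v y = anyUpTo? (λ m → ((m ≟ v) ⊎-dec (suc m ≟ v)) ×-dec (f m ≟ y)) N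

-- The labels (inside Fin K) carried by the edges at vertex v.  This is how a
-- labelling of the edges induces feature sets on the vertices.
labels : (f : ℕ → ℕ) (N v K : ℕ) → Subset K
labels f N v K = tabulate (does ∘ hasLabel? f N v ∘ toℕ)

∈-labels : ∀ {f N v K} {y : Fin K} → y ∈ labels f N v K ⇔ HasLabel f N v (toℕ y)
∈-labels {f} {N} {v} = ∈-tabulate (hasLabel? f N v ∘ toℕ)

CommonEdge : (N : ℕ) → Fin (suc N) → Fin (suc N) → Set
CommonEdge N u v = ∃ λ m → m < N × Ends (toℕ u) m × Ends (toℕ v) m

common-edge⇒adjacent : ∀ {N} {u v : Fin (suc N)} → u ≢ v → CommonEdge N u v → PathAdj (suc N) u v
common-edge⇒adjacent u≢v (_ , _ , inj₁ m≡u , inj₁ m≡v) = ⊥-elim (u≢v (toℕ-injective (trans (sym m≡u) m≡v)))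
common-edge⇒adjacent u≢v (_ , _ , inj₁ m≡u , inj₂ m+1≡v) = inj₁ (trans (cong suc (sym m≡u)) m+1≡v)
common-edge⇒adjacent u≢v (_ , _ , inj₂ m+1≡u , inj₁ m≡v) = inj₂ (trans (cong suc (sym m≡v)) m+1≡u)
common-edge⇒adjacent u≢v (_ , _ , inj₂ m+1≡u , inj₂ m+1≡v) = ⊥-elim (u≢v (toℕ-injective (trans (sym m+1≡u) m+1≡v)))

adjacent⇒common-edge : ∀ {N} {u v : Fin (suc N)} → PathAdj (suc N) u v → CommonEdge N u v
adjacent⇒common-edge {v = v} (inj₁ u+1≡v) =
  _ , s≤s⁻¹ (subst (_< _) (sym u+1≡v) (toℕ<n v)) , inj₁ refl , inj₂ u+1≡v
adjacent⇒common-edge {u = u} (inj₂ v+1≡u) =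
  _ , s≤s⁻¹ (subst (_< _) (sym v+1≡u) (toℕ<n u)) , inj₂ v+1≡u , inj₁ refl

-- Taking as features of a vertex the rows and the columns
-- of its edges yields an (α | β)-CIR of P_{N+1}: two vertices sharing a row and
-- a column share, by the corner lemma below, an edge in that very cell.
module RookWalk {N α β : ℕ} (row col : ℕ → ℕ)
    (row< : ∀ {m} → m < N → row m < α)
    (col< : ∀ {m} → m < N → col m < β)
    (cell-injective : ∀ {m m′} → m < N → m′ < N → row m ≡ row m′ → col m ≡ col m′ → m ≡ m′)
    (rook : ∀ {m} → suc m < N → row (suc m) ≡ row m ⊎ col (suc m) ≡ col m) where

  walk-CIR : CIR (suc N)
  walk-CIR = record
    { α = α ; β = β
    ; A = λ v → labels row N (toℕ v) α
    ; B = λ v → labels col N (toℕ v) β }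

  -- Corner lemma: the row of one edge at v and the column of another edge at v
  -- are together the cell of an edge at v (the two edges are consecutive, so
  -- they share a row or a column).
  corner : ∀ {v m₁ m₂} → m₁ < N → Ends v m₁ → m₂ < N → Ends v m₂ →
           ∃ λ m → m < N × Ends v m × row m ≡ row m₁ × col m ≡ col m₂
  corner m₁<N (inj₁ refl) _ (inj₁ refl) = _ , m₁<N , inj₁ refl , refl , refl
  corner {m₂ = m₂} m₁<N (inj₁ refl) m₂<N (inj₂ refl) with rook m₁<N
  ... | inj₁ same-row = m₂ , m₂<N , inj₂ refl , sym same-row , refl
  ... | inj₂ same-col = suc m₂ , m₁<N , inj₁ refl , refl , same-col
  corner {m₁ = m₁} m₁<N (inj₂ refl) m₂<N (inj₁ refl) with rook m₂<N
  ... | inj₁ same-row = suc m₁ , m₂<N , inj₁ refl , same-row , refl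
  ... | inj₂ same-col = m₁ , m₁<N , inj₂ refl , refl , sym same-col
  corner m₁<N (inj₂ refl) _ (inj₂ refl) = _ , m₁<N , inj₂ refl , refl , refl

  SharesFeatures : Fin (suc N) → Fin (suc N) → Set
  SharesFeatures u v = Nonempty (A walk-CIR u ∩ A walk-CIR v) × Nonempty (B walk-CIR u ∩ B walk-CIR v)

  shares-features⇔common-edge : ∀ u v → SharesFeatures u v ⇔ CommonEdge N u v
  shares-features⇔common-edge u v = mk⇔ features⇒edge edge⇒features
    where
    features⇒edge : SharesFeatures u v → CommonEdge N u v
    features⇒edge ((a , a∈) , (b , b∈))
      with Equivalence.to ∈-labels (proj₁ (x∈p∩q⁻ _ _ a∈)) | Equivalence.to ∈-labels (proj₂ (x∈p∩q⁻ _ _ a∈))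
         | Equivalence.to ∈-labels (proj₁ (x∈p∩q⁻ _ _ b∈)) | Equivalence.to ∈-labels (proj₂ (x∈p∩q⁻ _ _ b∈))
    ... | m₁ , l₁ , u₁ , r₁ | m₂ , l₂ , v₂ , r₂ | m₃ , l₃ , u₃ , c₃ | m₄ , l₄ , v₄ , c₄
      with corner l₁ u₁ l₃ u₃ | corner l₂ v₂ l₄ v₄
    ... | mᵤ , lᵤ , uᵤ , rᵤ , cᵤ | mᵥ , lᵥ , vᵥ , rᵥ , cᵥ
      with cell-injective lᵤ lᵥ (trans (trans rᵤ r₁) (sym (trans rᵥ r₂)))
                                (trans (trans cᵤ c₃) (sym (trans cᵥ c₄)))
    ... | refl = mᵤ , lᵤ , uᵤ , vᵥ
    edge⇒features : CommonEdge N u v → SharesFeatures u v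
    edge⇒features (m , m<N , u-m , v-m) =
      (fromℕ< (row< m<N) , x∈p∩q⁺ (at u-m (toℕ-fromℕ< (row< m<N)) , at v-m (toℕ-fromℕ< (row< m<N)))) ,
      (fromℕ< (col< m<N) , x∈p∩q⁺ (at u-m (toℕ-fromℕ< (col< m<N)) , at v-m (toℕ-fromℕ< (col< m<N))))
      where
      at : ∀ {f w K} {y : Fin K} → Ends w m → toℕ y ≡ f m → y ∈ labels f N w K
      at w-m y≡fm = Equivalence.from ∈-labels (m , m<N , w-m , sym y≡fm)

  walk-isCIR : 0 < N → IsCIR (PathAdj (suc N)) walk-CIR
  walk-isCIR 0<N = ≤-trans (s≤s z≤n) (row< 0<N) , ≤-trans (s≤s z≤n) (col< 0<N) , represents
    where
    represents : ∀ u v → u ≢ v → PathAdj (suc N) u v ⇔ SharesFeatures u v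
    represents u v u≢v = mk⇔
      (Equivalence.from (shares-features⇔common-edge u v) ∘ adjacent⇒common-edge)
      (common-edge⇒adjacent u≢v ∘ Equivalence.to (shares-features⇔common-edge u v))

divMod-unique : ∀ {s p} r .{{_ : NonZero s}} → p < s → (p + r * s) / s ≡ r × (p + r * s) % s ≡ p
divMod-unique {s} {p} r p<s = quotient , trans ([m+kn]%n≡m%n p r s) (m<n⇒m%n≡m p<s)
  where
  open ≡-Reasoning
  quotient : (p + r * s) / s ≡ r
  quotient = begin
    (p + r * s) / s    ≡⟨ +-distrib-/-∣ʳ p (divides-refl r) ⟩
    p / s + r * s / s  ≡⟨ cong₂ _+_ (m<n⇒m/n≡0 p<s) (m*n/n≡m r s) ⟩
    r                  ∎

-- If every
-- row starts in the column where the previous row ended, the walk is a rook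
-- walk: inside a row the row is kept, across rows the column is kept.
module SnakeGrid (s′ : ℕ) (ord : ℕ → ℕ → ℕ)
    (ord< : ∀ r {p} → p < suc s′ → ord r p < suc s′)
    (ord-injective : ∀ r {p q} → p < suc s′ → q < suc s′ → ord r p ≡ ord r q → p ≡ q)
    (ord-snake : ∀ r → ord (suc r) 0 ≡ ord r s′) where

  row pos col : ℕ → ℕ
  row m = m / suc s′
  pos m = m % suc s′
  col m = ord (row m) (pos m)

  pos< : ∀ m → pos m < suc s′
  pos< m = m%n<n m (suc s′)

  col< : ∀ m → col m < suc s′
  col< m = ord< (row m) (pos< m)

  row< : ∀ {m N α} → m < N → N ≤ α * suc s′ → row m < α
  row< m<N N≤αs = m<n*o⇒m/o<n (<-≤-trans m<N N≤αs)

  cell-of : ∀ {p} r → p < suc s′ → row (p + r * suc s′) ≡ r × col (p + r * suc s′) ≡ ord r p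
  cell-of r p<s with divMod-unique r p<s
  ... | row≡r , pos≡p = row≡r , cong₂ ord row≡r pos≡p

  cell-injective : ∀ {m m′} → row m ≡ row m′ → col m ≡ col m′ → m ≡ m′
  cell-injective {m} {m′} row≡ col≡ = begin
    m                        ≡⟨ m≡m%n+[m/n]*n m (suc s′) ⟩
    pos m + row m * suc s′   ≡⟨ cong₂ (λ p r → p + r * suc s′) pos≡ row≡ ⟩
    pos m′ + row m′ * suc s′ ≡⟨ m≡m%n+[m/n]*n m′ (suc s′) ⟨
    m′                       ∎
    where
    open ≡-Reasoning
    pos≡ : pos m ≡ pos m′
    pos≡ = ord-injective (row m) (pos< m) (pos< m′) (trans col≡ (cong (λ r → ord r (pos m′)) (sym row≡)))

  step-in-row : ∀ m → pos m ≢ s′ → suc (pos m) < suc s′ × row (suc m) ≡ row m × pos (suc m) ≡ suc (pos m)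
  step-in-row m not-last =
    next<s , subst (λ k → row k ≡ row m × pos k ≡ suc (pos m)) (sym next) (divMod-unique (row m) next<s)
    where
    next<s : suc (pos m) < suc s′
    next<s = ≤∧≢⇒< (pos< m) (not-last ∘ suc-injective)
    next : suc m ≡ suc (pos m) + row m * suc s′
    next = cong suc (m≡m%n+[m/n]*n m (suc s′))

  step-to-next-row : ∀ m → pos m ≡ s′ → row (suc m) ≡ suc (row m) × pos (suc m) ≡ 0
  step-to-next-row m last =
    subst (λ k → row k ≡ suc (row m) × pos k ≡ 0) (sym next) (divMod-unique {suc s′} (suc (row m)) (s≤s z≤n))
    where
    next : suc m ≡ 0 + suc (row m) * suc s′
    next = cong suc (trans (m≡m%n+[m/n]*n m (suc s′)) (cong (_+ row m * suc s′) last))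

  col-stays : ∀ m → pos m ≡ s′ → col (suc m) ≡ col m
  col-stays m last with step-to-next-row m last
  ... | row≡ , pos≡ = trans (cong₂ ord row≡ pos≡) (trans (ord-snake (row m)) (cong (ord (row m)) (sym last)))

  col-stays⇒row-ends : ∀ m → col (suc m) ≡ col m → pos m ≡ s′
  col-stays⇒row-ends m col≡ with pos m ≟ s′
  ... | yes last    = last
  ... | no not-last with step-in-row m not-last
  ...   | next<s , row≡ , pos≡ = contradiction
          (ord-injective (row m) next<s (pos< m) (trans (sym (cong₂ ord row≡ pos≡)) col≡))
          1+n≢n

  rook : ∀ m → row (suc m) ≡ row m ⊎ col (suc m) ≡ col m
  rook m with pos m ≟ s′
  ... | yes last    = inj₂ (col-stays m last)
  ... | no not-last = inj₁ (proj₁ (proj₂ (step-in-row m not-last)))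

-- Boustrophedon orderings: row 0 is read left to right, and the following
-- rows alternately in a given order ρ and in ρ reversed.  When ρ starts in
-- the last column s′ the rows join up, so these orderings form a snake grid.
module Boustrophedon (s′ : ℕ) (ρ : ℕ → ℕ)
    (ρ< : ∀ {p} → p < suc s′ → ρ p < suc s′)
    (ρ-injective : ∀ {p q} → p < suc s′ → q < suc s′ → ρ p ≡ ρ q → p ≡ q)
    (ρ-starts-last : ρ 0 ≡ s′) where

  turn : ℕ → ℕ → ℕ
  turn zero          p = p
  turn (suc zero)    p = s′ ∸ p
  turn (suc (suc r)) p = turn r p

  turn< : ∀ r {p} → p < suc s′ → turn r p < suc s′
  turn< zero          p<s = p<s
  turn< (suc zero)    {p} _ = s≤s (m∸n≤m s′ p)
  turn< (suc (suc r)) p<s = turn< r p<s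

  turn-injective : ∀ r {p q} → p < suc s′ → q < suc s′ → turn r p ≡ turn r q → p ≡ q
  turn-injective zero          _   _   p≡q = p≡q
  turn-injective (suc zero)    p<s q<s eq  = ∸-cancelˡ-≡ (s≤s⁻¹ p<s) (s≤s⁻¹ q<s) eq
  turn-injective (suc (suc r)) p<s q<s eq  = turn-injective r p<s q<s eq

  turn-joins : ∀ r → turn (suc r) 0 ≡ turn r s′
  turn-joins zero          = refl
  turn-joins (suc zero)    = sym (n∸n≡0 s′)
  turn-joins (suc (suc r)) = turn-joins r

  ord : ℕ → ℕ → ℕ
  ord zero    p = p
  ord (suc r) p = ρ (turn r p)

  ord< : ∀ r {p} → p < suc s′ → ord r p < suc s′
  ord< zero    p<s = p<s
  ord< (suc r) p<s = ρ< (turn< r p<s)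

  ord-injective : ∀ r {p q} → p < suc s′ → q < suc s′ → ord r p ≡ ord r q → p ≡ q
  ord-injective zero    _   _   p≡q = p≡q
  ord-injective (suc r) p<s q<s eq  = turn-injective r p<s q<s (ρ-injective (turn< r p<s) (turn< r q<s) eq)

  ord-snake : ∀ r → ord (suc r) 0 ≡ ord r s′
  ord-snake zero    = ρ-starts-last
  ord-snake (suc r) = cong ρ (turn-joins r)

-- A map on Fin k read as a map on ℕ (the identity outside Fin k).
onℕ : ∀ {k} → (Fin k → Fin k) → ℕ → ℕ
onℕ {k} π p with p <? k
... | yes p<k = toℕ (π (fromℕ< p<k))
... | no _    = p

onℕ< : ∀ {k} (π : Fin k → Fin k) {p} → p < k → onℕ π p < k
onℕ< {k} π {p} p<k with p <? k
... | yes _   = toℕ<n _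
... | no p≮k = contradiction p<k p≮k

onℕ-injective : ∀ {k} {π : Fin k → Fin k} → (∀ {i j} → π i ≡ π j → i ≡ j) →
                ∀ {p q} → p < k → q < k → onℕ π p ≡ onℕ π q → p ≡ q
onℕ-injective {k} π-injective {p} {q} p<k q<k eq with p <? k | q <? k
... | yes p<k′ | yes q<k′ = fromℕ<-injective p q p<k′ q<k′ (π-injective (toℕ-injective eq))
... | no p≮k   | _        = contradiction p<k p≮k
... | yes _    | no q≮k   = contradiction q<k q≮k

onℕ-toℕ : ∀ {k} (π : Fin k → Fin k) (i : Fin k) → onℕ π (toℕ i) ≡ toℕ (π i)
onℕ-toℕ {k} π i with toℕ i <? k
... | yes i<k = cong (toℕ ∘ π) (fromℕ<-toℕ i i<k)
... | no i≮k  = contradiction (toℕ<n i) i≮k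

-- The second row of the grids below: it starts in the last column s′ (where
-- the first row ends) and then visits the columns 0, …, s′-1 in the order π.
second-row : ∀ {s′} → (Fin s′ → Fin s′) → ℕ → ℕ
second-row {s′} π zero    = s′
second-row      π (suc p) = onℕ π p

-- Lehmer codes: c : Fin (k !) encodes an injective map Fin k → Fin k.  Its
-- leading digit (the quotient by (k-1)!) is the first value; the remaining
-- values are decoded from the rest of the code and punched around it.
digit : ∀ k → Fin (suc k !) → Fin (suc k)
digit k c = proj₁ (remQuot {suc k} (k !) c)

rest : ∀ k → Fin (suc k !) → Fin (k !)
rest k c = proj₂ (remQuot {suc k} (k !) c)

decode : (k : ℕ) → Fin (k !) → Fin k → Fin k
decode (suc k) c fzero    = digit k c
decode (suc k) c (fsuc p) = punchIn (digit k c) (decode k (rest k c) p)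

decode-injective : ∀ k c {p q} → decode k c p ≡ decode k c q → p ≡ q
decode-injective (suc k) c {fzero}  {fzero}  _  = refl
decode-injective (suc k) c {fzero}  {fsuc q} eq = contradiction (sym eq) (punchInᵢ≢i _ _)
decode-injective (suc k) c {fsuc p} {fzero}  eq = contradiction eq (punchInᵢ≢i _ _)
decode-injective (suc k) c {fsuc p} {fsuc q} eq =
  cong fsuc (decode-injective k _ (punchIn-injective _ _ _ eq))

-- A code is determined by all values but the last one.
decode-unique : ∀ k (c d : Fin (k !)) → (∀ p → suc (toℕ p) < k → decode k c p ≡ decode k d p) → c ≡ d
decode-unique zero          fzero fzero _ = refl
decode-unique (suc zero)    fzero fzero _ = refl
decode-unique (suc (suc k)) c     d     agree = begin
  c                                          ≡⟨ combine-remQuot {suc (suc k)} (suc k !) c ⟨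
  combine (digit (suc k) c) (rest (suc k) c) ≡⟨ cong₂ combine digit≡ (decode-unique (suc k) _ _ rest-agree) ⟩
  combine (digit (suc k) d) (rest (suc k) d) ≡⟨ combine-remQuot {suc (suc k)} (suc k !) d ⟩
  d                                          ∎
  where
  open ≡-Reasoning
  digit≡ : digit (suc k) c ≡ digit (suc k) d
  digit≡ = agree fzero (s≤s (s≤s z≤n))
  rest-agree : ∀ p → suc (toℕ p) < suc k → decode (suc k) (rest (suc k) c) p ≡ decode (suc k) (rest (suc k) d) p
  rest-agree p p+1<k =
    punchIn-injective _ _ _ (trans (agree (fsuc p) (s≤s p+1<k)) (cong (λ a → punchIn a _) (sym digit≡)))

image-subsingleton : ∀ {a b} {f : Fin a → Fin b} {X : Subset a} {Y : Subset b} → IsImage f X Y →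
                     (∀ {x x′} → x ∈ X → x′ ∈ X → x ≡ x′) → ∀ {y y′} → y ∈ Y → y′ ∈ Y → y ≡ y′
image-subsingleton {f = f} image X-subsingleton {y} {y′} y∈ y′∈
  with Equivalence.to (image y) y∈ | Equivalence.to (image y′) y′∈
... | _ , x∈ , refl | _ , x′∈ , refl = cong f (X-subsingleton x∈ x′∈)

module Family (N s′ α : ℕ) (0<s′ : 0 < s′) (2s′<N : suc (s′ + s′) ≤ N) (N≤αs : N ≤ α * suc s′) where

  private
    π : Fin (s′ !) → Fin s′ → Fin s′
    π = decode s′

    ρ : Fin (s′ !) → ℕ → ℕ
    ρ c = second-row (π c)

    ρ< : ∀ c {p} → p < suc s′ → ρ c p < suc s′
    ρ< c {zero}  _     = n<1+n s′
    ρ< c {suc p} p+1<s = m<n⇒m<1+n (onℕ< (π c) (s≤s⁻¹ p+1<s))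

    ρ-injective : ∀ c {p q} → p < suc s′ → q < suc s′ → ρ c p ≡ ρ c q → p ≡ q
    ρ-injective c {zero}  {zero}  _ _ _ = refl
    ρ-injective c {zero}  {suc q} _ q<s eq = contradiction (sym eq) (<⇒≢ (onℕ< (π c) (s≤s⁻¹ q<s)))
    ρ-injective c {suc p} {zero}  p<s _ eq = contradiction eq (<⇒≢ (onℕ< (π c) (s≤s⁻¹ p<s)))
    ρ-injective c {suc p} {suc q} p<s q<s eq =
      cong suc (onℕ-injective (decode-injective s′ c) (s≤s⁻¹ p<s) (s≤s⁻¹ q<s) eq)

    module Order (c : Fin (s′ !)) = Boustrophedon s′ (ρ c) (ρ< c) (ρ-injective c) refl
    module Grid (c : Fin (s′ !)) = SnakeGrid s′ (Order.ord c) (Order.ord< c) (Order.ord-injective c) (Order.ord-snake c)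
    module Walk (c : Fin (s′ !)) = RookWalk {N} {α} {suc s′} (Grid.row c) (Grid.col c)
      (λ m<N → Grid.row< c m<N N≤αs) (λ {m} _ → Grid.col< c m)
      (λ _ _ → Grid.cell-injective c) (λ {m} _ → Grid.rook c m)

  R : Fin (s′ !) → CIR (suc N)
  R = Walk.walk-CIR

  represents : ∀ c → IsCIR (PathAdj (suc N)) (R c)
  represents c = Walk.walk-isCIR c (<-≤-trans (s≤s z≤n) 2s′<N)

  private
    s≤N : suc s′ ≤ N
    s≤N = ≤-trans (s≤s (m≤m+n s′ s′)) 2s′<N

    col-first-row : ∀ c {k} → k < suc s′ → Grid.col c k ≡ k
    col-first-row c {k} k<s = subst (λ m → Grid.col c m ≡ k) (+-identityʳ k) (proj₂ (Grid.cell-of c 0 k<s))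

    col-second-row : ∀ c {q} → q < suc s′ → Grid.col c (q + 1 * suc s′) ≡ ρ c q
    col-second-row c q<s = proj₂ (Grid.cell-of c 1 q<s)

    second-row-edge< : ∀ {q} → q < s′ → q + 1 * suc s′ < N
    second-row-edge< {q} q<s′ = <-≤-trans (+-monoˡ-< (1 * suc s′) q<s′)
      (≤-trans (≤-reflexive (trans (cong (s′ +_) (+-identityʳ (suc s′))) (+-suc s′ s′))) 2s′<N)

    labels-at : ∀ {f K k} (k<n : k < suc N) {y : Fin K} →
                y ∈ labels f N (toℕ (fromℕ< k<n)) K ⇔ HasLabel f N k (toℕ y)
    labels-at {f} {K} {k} k<n {y} =
      subst (λ v → y ∈ labels f N (toℕ (fromℕ< k<n)) K ⇔ HasLabel f N v (toℕ y)) (toℕ-fromℕ< k<n) ∈-labels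

    1<n : 1 < suc N
    1<n = s≤s (<-≤-trans (s≤s z≤n) 2s′<N)

    vertex₁ : Fin (suc N)
    vertex₁ = fromℕ< 1<n

  -- Swapped roles are impossible: vertex 1 has a single row feature (both
  -- its edges lie in row 0) but two column features, 0 and 1.
  no-swap : ∀ c d (φ : Fin α → Fin (suc s′)) → ¬ IsImage φ (A (R c) vertex₁) (B (R d) vertex₁)
  no-swap c d φ image =
    contradiction (trans (cong toℕ (image-subsingleton image one-row column₀∈ column₁∈)) (toℕ-fromℕ< 1<s)) λ ()
    where
    1<s : 1 < suc s′
    1<s = s≤s 0<s′
    column₀ column₁ : Fin (suc s′)
    column₀ = fzero
    column₁ = fromℕ< 1<s
    column₀∈ : column₀ ∈ B (R d) vertex₁
    column₀∈ = Equivalence.from (labels-at 1<n)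
      (0 , <-≤-trans (s≤s z≤n) 2s′<N , inj₂ refl , col-first-row d (s≤s z≤n))
    column₁∈ : column₁ ∈ B (R d) vertex₁
    column₁∈ = Equivalence.from (labels-at 1<n)
      (1 , <-≤-trans 1<s s≤N , inj₁ refl , trans (col-first-row d 1<s) (sym (toℕ-fromℕ< 1<s)))
    in-row-0 : ∀ {x} → x ∈ A (R c) vertex₁ → toℕ x ≡ 0
    in-row-0 x∈ with Equivalence.to (labels-at 1<n) x∈
    ... | m , _ , m-at-1 , row≡x = trans (sym row≡x) (m<n⇒m/n≡0 (edge<s m-at-1))
      where
      edge<s : ∀ {m} → Ends 1 m → m < suc s′
      edge<s (inj₁ refl) = 1<s
      edge<s (inj₂ refl) = s≤s z≤n
    one-row : ∀ {x x′} → x ∈ A (R c) vertex₁ → x′ ∈ A (R c) vertex₁ → x ≡ x′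
    one-row x∈ x′∈ = toℕ-injective (trans (in-row-0 x∈) (sym (in-row-0 x′∈)))

  -- Same roles: a column permutation ψ preserving all column feature sets
  -- follows every edge (by induction along the path, using that R c and R d
  -- change rows at the same edges), is therefore the identity on row 0, and
  -- so R c and R d have the same columns; row 1 then forces c ≡ d.
  module SameRoles (c d : Fin (s′ !)) (ψ : Fin (suc s′) ⤖ Fin (suc s′))
      (preserves : ∀ v → IsImage (Bijection.to ψ) (B (R c) v) (B (R d) v)) where

    private
      ψ′ : Fin (suc s′) → Fin (suc s′)
      ψ′ = Bijection.to ψ

      ψ-maps : ∀ {k} → k < suc N → ∀ {b} →
               HasLabel (Grid.col c) N k (toℕ b) → HasLabel (Grid.col d) N k (toℕ (ψ′ b))
      ψ-maps k<n {b} b-at-k = Equivalence.to (labels-at k<n)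
        (Equivalence.from (preserves (fromℕ< k<n) (ψ′ b)) (b , Equivalence.from (labels-at k<n) b-at-k , refl))

    -- ψ sends the column of edge m in R c to its column in R d.  At a row
    -- change the column stays in R c, hence (same rows) also in R d.
    ψ-tracks : ∀ m → m < N → ∀ b → toℕ b ≡ Grid.col c m → toℕ (ψ′ b) ≡ Grid.col d m
    ψ-tracks zero 0<N b b≡ with ψ-maps (s≤s z≤n) (0 , 0<N , inj₁ refl , sym b≡)
    ... | _ , _ , inj₁ refl , col≡ = sym col≡
    ψ-tracks (suc m) m+1<N b b≡ with ψ-maps (s≤s (<⇒≤ m+1<N)) (suc m , m+1<N , inj₁ refl , sym b≡)
    ... | _ , _ , inj₁ refl , col≡ = sym col≡
    ... | _ , _ , inj₂ refl , col≡ = trans (sym col≡) (sym (Grid.col-stays d m row-ends))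
      where
      b′ : Fin (suc s′)
      b′ = fromℕ< (Grid.col< c m)
      b≡b′ : b ≡ b′
      b≡b′ = Bijection.injective ψ (toℕ-injective
        (trans (sym col≡) (sym (ψ-tracks m (<-trans (n<1+n m) m+1<N) b′ (toℕ-fromℕ< _)))))
      row-ends : Grid.pos c m ≡ s′
      row-ends = Grid.col-stays⇒row-ends c m (trans (sym b≡) (trans (cong toℕ b≡b′) (toℕ-fromℕ< _)))

    -- Row 0 of every grid is read left to right, so ψ is the identity.
    ψ-fixes : ∀ b → toℕ (ψ′ b) ≡ toℕ b
    ψ-fixes b = trans (ψ-tracks (toℕ b) (<-≤-trans (toℕ<n b) s≤N) b (sym (col-first-row c (toℕ<n b))))
                      (col-first-row d (toℕ<n b))

    cols-agree : ∀ m → m < N → Grid.col c m ≡ Grid.col d m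
    cols-agree m m<N = trans (sym (toℕ-fromℕ< _))
      (trans (sym (ψ-fixes b)) (ψ-tracks m m<N b (toℕ-fromℕ< _)))
      where
      b : Fin (suc s′)
      b = fromℕ< (Grid.col< c m)

    codes-agree : c ≡ d
    codes-agree = decode-unique s′ c d λ p p+1<s′ → toℕ-injective (begin
      toℕ (π c p)                            ≡⟨ onℕ-toℕ (π c) p ⟨
      ρ c (suc (toℕ p))                      ≡⟨ col-second-row c (m<n⇒m<1+n p+1<s′) ⟨
      Grid.col c (suc (toℕ p) + 1 * suc s′)  ≡⟨ cols-agree _ (second-row-edge< p+1<s′) ⟩
      Grid.col d (suc (toℕ p) + 1 * suc s′)  ≡⟨ col-second-row d (m<n⇒m<1+n p+1<s′) ⟩
      ρ d (suc (toℕ p))                      ≡⟨ onℕ-toℕ (π d) p ⟩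
      toℕ (π d p)                            ∎)
      where open ≡-Reasoning

  nonequivalent : ∀ c d → c ≢ d → ¬ Equivalent (R c) (R d)
  nonequivalent c d c≢d (inj₁ (_ , ψ , preserves)) = c≢d (SameRoles.codes-agree c d ψ (proj₂ ∘ preserves))
  nonequivalent c d c≢d (inj₂ (φ , _ , maps))       = no-swap c d (Bijection.to φ) (proj₁ (maps vertex₁))

-- For s′ ≥ 2, s′² < N gives 2s′ < N: the first two grid rows (minus one cell) fit.
double<square : ∀ {s′ N} → 2 ≤ s′ → s′ * s′ < N → suc (s′ + s′) ≤ N
double<square {s′} 2≤s′ s′²<N =
  ≤-trans (s≤s (≤-trans (≤-reflexive (cong (s′ +_) (sym (+-identityʳ s′)))) (*-monoˡ-≤ s′ 2≤s′))) s′²<N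

-- The main construction, for s′ = ⌈√N⌉ - 1 ≥ 2.  With s′ + 1 columns, s′
-- rows suffice when N ≤ s′(s′+1) and s′ + 1 rows otherwise; in both cases the
-- size meets the optimality bound.
optimal-family : ∀ N s′ → 2 ≤ s′ → s′ * s′ < N → N ≤ suc s′ * suc s′ →
  Σ (Fin (s′ !) → CIR (suc N)) λ F →
    (∀ i → IsOptimalCIR (PathAdj (suc N)) (F i)) × (∀ i j → i ≢ j → ¬ Equivalent (F i) (F j))
optimal-family N s′ 2≤s′ s′²<N N≤[s′+1]² with N ≤? s′ * suc s′
... | yes N≤s′[s′+1] = F.R , (λ c → F.represents c , optimal) , F.nonequivalent
  where
  module F = Family N s′ s′ (<-≤-trans (s≤s z≤n) 2≤s′) (double<square 2≤s′ s′²<N) N≤s′[s′+1]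
  optimal : ∀ R → IsCIR (PathAdj (suc N)) R → s′ + suc s′ ≤ size R
  optimal R rep = subst (_≤ size R) (sym (+-suc s′ s′)) (size-lower-bound ≤-refl (n≤1+n s′) s′²<N R rep)
... | no N≰s′[s′+1] = F.R , (λ c → F.represents c , optimal) , F.nonequivalent
  where
  module F = Family N s′ (suc s′) (<-≤-trans (s≤s z≤n) 2≤s′) (double<square 2≤s′ s′²<N) N≤[s′+1]²
  optimal : ∀ R → IsCIR (PathAdj (suc N)) R → suc s′ + suc s′ ≤ size R
  optimal = size-lower-bound (n≤1+n s′) ≤-refl (≰⇒> N≰s′[s′+1])

root≥3 : ∀ {N s} → 5 ≤ N → N ≤ s * s → 3 ≤ s
root≥3 5≤N N≤s² = ≰⇒> λ s≤2 → <⇒≱ 5≤N (≤-trans N≤s² (*-mono-≤ s≤2 s≤2))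

theorem7 : ∀ (n s : ℕ) → 6 ≤ n → IsCeilSqrt (n ∸ 1) s →
    Σ (Fin ((s ∸ 1) !) → CIR n) λ F →
      (∀ i → IsOptimalCIR (PathAdj n) (F i)) ×
      (∀ i j → i ≢ j → ¬ Equivalent (F i) (F j))
theorem7 (suc N) s (s≤s 5≤N) (s′²<N , N≤s²) with root≥3 {N} {s} 5≤N N≤s²
... | s≤s (s≤s (s≤s _)) = optimal-family N (s ∸ 1) (s≤s (s≤s z≤n)) s′²<N N≤s²
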